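{- Let $(M,d)$ be a metric space (pseudo-metrics allowed), $k\ge1$, and let $s_1,\dots,s_k, a_1,\dots,a_k\in M$ with $s_j=a_j$ for all $j\ge 2$, and let $E_1,\dots,E_k\in\mathbb R$. For such data define the Teia potential $\Phi(s,a,E)$: with $\alpha_{\{x\},\{y,z\}}=\tfrac12(d(x,y)+d(x,z)-d(y,z))$, $\mathcal D=\sum_{1\le i<j\le k}d(s_i,s_j)$, $\mathcal M=k\sum_{i=1}^k d(a_i,s_i)$, $\varepsilon^i_j=\alpha_{\{s_j\},\{a_j,s_i\}}$, $\varepsilon^i=\sum_{j}\varepsilon^i_j$, $e_i=E_i-\varepsilon^i$, $e_{\max}=\max_i e_i$, $\mathcal H=2\sum_{i=1}^k(e_{\max}-E_i)$, $\Phi=\mathcal D+\mathcal M+\mathcal H$. Consider a lazy request $r=a_1$ served by HANDICAP: choose an index $i$ minimizing $E_i+d(s_i,r)$ (ties broken arbitrarily), set $E'_j=E_j+\alpha_{\{r\},\{s_i,s_j\}}$ for all $j$ (so $E'_i=E_i+d(s_i,r)$), and move server $i$ to $r$. Define the new configuration $(s',a')$ by: if $i=1$, then $s'_1=r$, $s'_j=s_j$ for $j\ge2$, and $a'=a$; if $i\ne1$, then $s'_i=a'_i=r$, $s'_1=s_1$, $a'_1=a_i$, and $s'_j=s_j$, $a'_j=a_j$ for $j\notin\{1,i\}$. Then (the new configuration again satisfies $s'_j=a'_j$ for $j\ge 2$ and) $$\Phi(s',a',E')-\Phi(s,a,E)+d(s_i,r)\le 0 .$$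
   Context: Setting: the $k$-server problem and Teia's algorithm HANDICAP, which keeps a real "handicap" $E_j$ for each of its servers (initially all $0$). On a request $r$ it picks $i$ minimizing $E_i+d(s_i,r)$, adds the isolation index $\alpha_{\{r\},\{s_i,s_j\}}=\tfrac12(d(r,s_i)+d(r,s_j)-d(s_i,s_j))$ to $E_j$ for every $j$, and moves $s_i$ to $r$. Here $s_i$ are the algorithm's server positions, $a_i$ the adversary's, with $s_i$ paired with $a_i$ and $a_1$ the adversary's only possibly open server. A lazy request is a request at the adversary's open server position $a_1$, costing the adversary nothing; after it, the adversary's servers are relabeled as described so that the pairing is preserved. The inequality is the update condition $\Delta\Phi-k\cdot\mathrm{cost}_{adv}+\mathrm{cost}_{alg}\le0$ with $\mathrm{cost}_{adv}=0$ and $\mathrm{cost}_{alg}=d(s_i,r)$. -}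

module Defs where

open import Level using (0ℓ)
open import Data.Nat using (ℕ; zero; suc)
open import Data.Fin using (Fin; zero; suc; _<?_)
open import Data.Fin.Properties using (_≟_)
open import Data.Sum using (_⊎_; inj₁; inj₂)
open import Data.Product using (Σ; _×_)
open import Relation.Nullary using (¬_; yes; no)
open import Relation.Binary.PropositionalEquality using (_≡_)
open import Relation.Binary.Structures using (IsTotalOrder)
open import Algebra.Bundles using (CommutativeRing)

-- The real numbers are not available in agda-stdlib.  We state the lemma for an
-- arbitrary (linearly) ordered field, of which ℝ is an instance.
record OrderedField : Set₁ where
  field
    commRing : CommutativeRing 0ℓ 0ℓ
  open CommutativeRing commRing public hiding (zero)
  infix 4 _≤_
  field
    _≤_          : Carrier → Carrier → Set
    isTotalOrder : IsTotalOrder _≈_ _≤_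
    +-mono-≤     : ∀ {x y} z → x ≤ y → x + z ≤ y + z
    *-nonneg     : ∀ {x y} → 0# ≤ x → 0# ≤ y → 0# ≤ x * y
    0≉1          : ¬ (0# ≈ 1#)
    inverse      : ∀ x → ¬ (x ≈ 0#) → Σ Carrier (λ y → x * y ≈ 1#)
    half         : Carrier
    half-spec    : half + half ≈ 1#

  open IsTotalOrder isTotalOrder public using (total)

  max : Carrier → Carrier → Carrier
  max x y with total x y
  ... | inj₁ _ = y
  ... | inj₂ _ = x

  sumF : (n : ℕ) → (Fin n → Carrier) → Carrier
  sumF zero    f = 0#
  sumF (suc n) f = f zero + sumF n (λ j → f (suc j))

  maxF : (n : ℕ) → (Fin (suc n) → Carrier) → Carrier
  maxF zero    f = f zero
  maxF (suc n) f = max (f zero) (maxF n (λ j → f (suc j)))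

  nat : ℕ → Carrier
  nat zero    = 0#
  nat (suc n) = 1# + nat n

record PseudoMetric (F : OrderedField) (M : Set) : Set where
  open OrderedField F
  field
    d      : M → M → Carrier
    d-refl : ∀ x → d x x ≈ 0#
    d-sym  : ∀ x y → d x y ≈ d y x
    d-tri  : ∀ x y z → d x z ≤ d x y + d y z

module Teia (F : OrderedField) {M : Set} (Met : PseudoMetric F M) where
  open OrderedField F
  open PseudoMetric Met

  α : M → M → M → Carrier
  α x y z = half * (d x y + d x z - d y z)

  -- k = suc n servers, indexed by Fin (suc n); index zero is server 1.
  module _ (n : ℕ) where
    k : ℕ
    k = suc n

    𝒟 : (Fin k → M) → Carrier
    𝒟 s = sumF k (λ i → sumF k (λ j → pair i j))
      where
      pair : Fin k → Fin k → Carrier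
      pair i j with i <? j
      ... | yes _ = d (s i) (s j)
      ... | no  _ = 0#

    ℳ : (Fin k → M) → (Fin k → M) → Carrier
    ℳ s a = nat k * sumF k (λ i → d (a i) (s i))

    εij : (Fin k → M) → (Fin k → M) → Fin k → Fin k → Carrier
    εij s a i j = α (s j) (a j) (s i)

    εi : (Fin k → M) → (Fin k → M) → Fin k → Carrier
    εi s a i = sumF k (λ j → εij s a i j)

    e : (Fin k → M) → (Fin k → M) → (Fin k → Carrier) → Fin k → Carrier
    e s a E i = E i - εi s a i

    emax : (Fin k → M) → (Fin k → M) → (Fin k → Carrier) → Carrier
    emax s a E = maxF n (e s a E)

    ℋ : (Fin k → M) → (Fin k → M) → (Fin k → Carrier) → Carrier
    ℋ s a E = (1# + 1#) * sumF k (λ i → emax s a E - E i)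

    Φ : (Fin k → M) → (Fin k → M) → (Fin k → Carrier) → Carrier
    Φ s a E = 𝒟 s + ℳ s a + ℋ s a E

    newE : (Fin k → M) → (Fin k → Carrier) → Fin k → M → Fin k → Carrier
    newE s E i r j = E j + α r (s i) (s j)

    newS : (Fin k → M) → Fin k → M → Fin k → M
    newS s i r j with j ≟ i
    ... | yes _ = r
    ... | no  _ = s j

    newA : (Fin k → M) → Fin k → M → Fin k → M
    newA a zero    r j = a j
    newA a (suc m) r zero = a (suc m)
    newA a (suc m) r (suc j) with suc j ≟ suc m
    ... | yes _ = r
    ... | no  _ = a (suc j)

{-# OPTIONS --safe #-}
-- After a lazy request r = a₁ only server 1 can be unmatched, so ℳ = k·d(a₁,s₁) and
-- εˡ = α(s₁,a₁,sₗ).  With βₗ = α(r,sᵢ,sₗ) the handicap increments, every new eₗ is at most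
-- e_max + β₁: for servers that do not move this is an identity between isolation indices,
-- for the moving server i it is the greedy choice of i.  Hence ℋ grows by at most
-- 2Σₗ(β₁ − βₗ), and since 2(β₁ − βₗ) = (d(r,s₁) − d(sᵢ,s₁)) − (d(r,sₗ) − d(sᵢ,sₗ)) this
-- growth cancels exactly against the changes of 𝒟 and ℳ and the cost d(sᵢ,r).
module Submission where

open import Level using (0ℓ)
open import Algebra.Bundles using (CommutativeRing)
open import Algebra.Solver.Ring.AlmostCommutativeRing
open import Data.Bool using (if_then_else_)
open import Data.Fin using (Fin; zero; suc; _<?_)
open import Data.Fin.Properties using (_≟_; <-cmp; <⇒≢)
open import Data.Integer as ℤ using (ℤ; +_; -[1+_]; _⊖_)
import Data.Integer.Properties as ℤ
open import Data.Maybe using (Maybe; just; nothing)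
open import Data.Nat as ℕ using (ℕ; zero; suc)
import Data.Nat.Properties as ℕ
open import Data.Product using (Σ; _×_; _,_; proj₁; proj₂)
open import Data.Sign as Sign using (Sign)
open import Data.Sum using (inj₁; inj₂)
open import Function using (_∘_)
open import Relation.Binary.Bundles using (Poset)
open import Relation.Binary.Definitions using (tri<; tri≈; tri>)
open import Relation.Binary.PropositionalEquality as ≡ using (_≡_; _≢_)
open import Relation.Binary.Structures using (IsTotalOrder)
open import Relation.Nullary using (Dec; yes; no; ¬_; does)
open import Relation.Nullary.Decidable using (dec-true; dec-false)
open import Relation.Nullary.Negation using (contradiction)
import Relation.Binary.Reasoning.PartialOrder as PartialOrderReasoning
import Relation.Binary.Reasoning.Setoid as SetoidReasoning

open import Defs

module IntegerCoefficientSolver {c ℓ} (R : CommutativeRing c ℓ) where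
  open CommutativeRing R
  open import Algebra.Properties.Semiring.Mult.TCOptimised semiring using (×-homo-+; ×1-homo-*; 1+×)
    renaming (_×_ to _×′_)
  open import Algebra.Properties.Ring ring using (-1*x≈-x)
  open import Algebra.Properties.AbelianGroup +-abelianGroup using (⁻¹-∙-comm)
  open import Algebra.Properties.Group +-group using (ε⁻¹≈ε; ⁻¹-involutive)
  open import Algebra.Properties.CommutativeSemigroup +-commutativeSemigroup
    using () renaming (interchange to +-interchange)
  open import Algebra.Properties.CommutativeSemigroup *-commutativeSemigroup
    using () renaming (interchange to *-interchange)
  open import Relation.Binary.Reasoning.Setoid setoid

  ι : ℤ → Carrier
  ι (+ n)    = n ×′ 1#
  ι -[1+ n ] = - (suc n ×′ 1#)

  ι-⊖ : ∀ m n → ι (m ⊖ n) ≈ m ×′ 1# - n ×′ 1#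
  ι-⊖ zero    zero    = sym (-‿inverseʳ 0#)
  ι-⊖ (suc m) zero    = sym (trans (+-congˡ ε⁻¹≈ε) (+-identityʳ _))
  ι-⊖ zero    (suc n) = sym (+-identityˡ _)
  ι-⊖ (suc m) (suc n) = begin
    ι (suc m ⊖ suc n)                  ≡⟨ ≡.cong ι (ℤ.[1+m]⊖[1+n]≡m⊖n m n) ⟩
    ι (m ⊖ n)                          ≈⟨ ι-⊖ m n ⟩
    m ×′ 1# - n ×′ 1#                  ≈⟨ +-identityˡ _ ⟨
    0# + (m ×′ 1# - n ×′ 1#)           ≈⟨ +-congʳ (-‿inverseʳ 1#) ⟨
    (1# - 1#) + (m ×′ 1# - n ×′ 1#)    ≈⟨ +-interchange _ _ _ _ ⟩
    (1# + m ×′ 1#) + (- 1# - n ×′ 1#)  ≈⟨ +-cong (sym (1+× m 1#)) (trans (⁻¹-∙-comm _ _) (-‿cong (sym (1+× n 1#)))) ⟩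
    suc m ×′ 1# - suc n ×′ 1#          ∎

  ι-+ : ∀ i j → ι (i ℤ.+ j) ≈ ι i + ι j
  ι-+ (+ m)    (+ n)    = ×-homo-+ 1# m n
  ι-+ (+ m)    -[1+ n ] = ι-⊖ m (suc n)
  ι-+ -[1+ m ] (+ n)    = trans (ι-⊖ n (suc m)) (+-comm _ _)
  ι-+ -[1+ m ] -[1+ n ] = begin
    - (suc (suc (m ℕ.+ n)) ×′ 1#)  ≡⟨ ≡.cong (λ t → - (suc t ×′ 1#)) (ℕ.+-suc m n) ⟨
    - ((suc m ℕ.+ suc n) ×′ 1#)    ≈⟨ -‿cong (×-homo-+ 1# (suc m) (suc n)) ⟩
    - (suc m ×′ 1# + suc n ×′ 1#)  ≈⟨ ⁻¹-∙-comm _ _ ⟨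
    - (suc m ×′ 1#) - suc n ×′ 1#  ∎

  ⟦_⟧ₛ : Sign → Carrier
  ⟦ Sign.+ ⟧ₛ = 1#
  ⟦ Sign.- ⟧ₛ = - 1#

  ⟦⟧ₛ-* : ∀ σ τ → ⟦ σ Sign.* τ ⟧ₛ ≈ ⟦ σ ⟧ₛ * ⟦ τ ⟧ₛ
  ⟦⟧ₛ-* Sign.+ τ      = sym (*-identityˡ _)
  ⟦⟧ₛ-* Sign.- Sign.+ = sym (*-identityʳ _)
  ⟦⟧ₛ-* Sign.- Sign.- = sym (trans (-1*x≈-x _) (⁻¹-involutive _))

  ι-◃ : ∀ σ m → ι (σ ℤ.◃ m) ≈ ⟦ σ ⟧ₛ * m ×′ 1#
  ι-◃ σ      zero    = sym (zeroʳ _)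
  ι-◃ Sign.+ (suc m) = sym (*-identityˡ _)
  ι-◃ Sign.- (suc m) = sym (-1*x≈-x _)

  ι-signAbs : ∀ i → ι i ≈ ⟦ ℤ.sign i ⟧ₛ * ℤ.∣ i ∣ ×′ 1#
  ι-signAbs i = trans (reflexive (≡.cong ι (≡.sym (ℤ.◃-inverse i)))) (ι-◃ (ℤ.sign i) ℤ.∣ i ∣)

  ι-* : ∀ i j → ι (i ℤ.* j) ≈ ι i * ι j
  ι-* i j = begin
    ι (σ Sign.* τ ℤ.◃ m ℕ.* n)               ≈⟨ ι-◃ (σ Sign.* τ) (m ℕ.* n) ⟩
    ⟦ σ Sign.* τ ⟧ₛ * (m ℕ.* n) ×′ 1#         ≈⟨ *-cong (⟦⟧ₛ-* σ τ) (×1-homo-* m n) ⟩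
    (⟦ σ ⟧ₛ * ⟦ τ ⟧ₛ) * (m ×′ 1# * n ×′ 1#)  ≈⟨ *-interchange _ _ _ _ ⟩
    (⟦ σ ⟧ₛ * m ×′ 1#) * (⟦ τ ⟧ₛ * n ×′ 1#)  ≈⟨ *-cong (ι-signAbs i) (ι-signAbs j) ⟨
    ι i * ι j                                ∎
    where
    σ τ : Sign
    σ = ℤ.sign i
    τ = ℤ.sign j
    m n : ℕ
    m = ℤ.∣ i ∣
    n = ℤ.∣ j ∣

  ι-neg : ∀ i → ι (ℤ.- i) ≈ - ι i
  ι-neg (+ zero)  = sym ε⁻¹≈ε
  ι-neg (+ suc n) = refl
  ι-neg -[1+ n ]  = sym (⁻¹-involutive _)

  ι-homomorphism : ℤ.+-*-rawRing -Raw-AlmostCommutative⟶ fromCommutativeRing R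
  ι-homomorphism = record
    { ⟦_⟧ = ι ; +-homo = ι-+ ; *-homo = ι-* ; -‿homo = ι-neg ; 0-homo = refl ; 1-homo = refl }

  ι-≟ : ∀ i j → Maybe (ι i ≈ ι j)
  ι-≟ i j with i ℤ.≟ j
  ... | yes ≡.refl = just refl
  ... | no _       = nothing

  open import Algebra.Solver.Ring ℤ.+-*-rawRing (fromCommutativeRing R) ι-homomorphism ι-≟ public

module OrderedFieldProperties (F : OrderedField) where
  open OrderedField F
  open IsTotalOrder isTotalOrder public
    using () renaming (refl to ≤-refl; reflexive to ≤-reflexive; trans to ≤-trans)

  poset : Poset 0ℓ 0ℓ 0ℓ
  poset = record { isPartialOrder = IsTotalOrder.isPartialOrder isTotalOrder }

  module ≤-Reasoning = PartialOrderReasoning poset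
  module ≈-Reasoning = SetoidReasoning setoid

  +-monoʳ-≤ : ∀ z {x y} → x ≤ y → z + x ≤ z + y
  +-monoʳ-≤ z {x} {y} x≤y = begin
    z + x  ≈⟨ +-comm z x ⟩
    x + z  ≤⟨ +-mono-≤ z x≤y ⟩
    y + z  ≈⟨ +-comm y z ⟩
    z + y  ∎
    where
    open ≤-Reasoning

  +-mono₂-≤ : ∀ {x y u v} → x ≤ y → u ≤ v → x + u ≤ y + v
  +-mono₂-≤ {y = y} {u} x≤y u≤v = ≤-trans (+-mono-≤ u x≤y) (+-monoʳ-≤ y u≤v)

  two : Carrier
  two = 1# + 1#

  two*x≈x+x : ∀ x → two * x ≈ x + x
  two*x≈x+x x = trans (distribʳ x 1# 1#) (+-cong (*-identityˡ x) (*-identityˡ x))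

  two*-mono-≤ : ∀ {x y} → x ≤ y → two * x ≤ two * y
  two*-mono-≤ {x} {y} x≤y = begin
    two * x  ≈⟨ two*x≈x+x x ⟩
    x + x    ≤⟨ +-mono₂-≤ x≤y x≤y ⟩
    y + y    ≈⟨ two*x≈x+x y ⟨
    two * y  ∎
    where
    open ≤-Reasoning

  two*half≈1 : two * half ≈ 1#
  two*half≈1 = trans (two*x≈x+x half) half-spec

  a+c≈b+d⇒x+a-b≈x-c+d : ∀ x {a b c d} → a + c ≈ b + d → (x + a) - b ≈ (x - c) + d
  a+c≈b+d⇒x+a-b≈x-c+d x {a} {b} {c} {d} a+c≈b+d = begin
    (x + a) - b              ≈⟨ solve 4 (λ x a b c → (x :+ a) :- b := (x :- c) :+ ((a :+ c) :- b)) refl x a b c ⟩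
    (x - c) + ((a + c) - b)  ≈⟨ +-congˡ (+-congʳ a+c≈b+d) ⟩
    (x - c) + ((b + d) - b)  ≈⟨ solve 4 (λ x b c d → (x :- c) :+ ((b :+ d) :- b) := (x :- c) :+ d) refl x b c d ⟩
    (x - c) + d              ∎
    where
    open IntegerCoefficientSolver commRing using (solve; _:+_; _:-_; _:=_)
    open ≈-Reasoning

  max-ubˡ : ∀ x y → x ≤ max x y
  max-ubˡ x y with total x y
  ... | inj₁ x≤y = x≤y
  ... | inj₂ _   = ≤-refl

  max-ubʳ : ∀ x y → y ≤ max x y
  max-ubʳ x y with total x y
  ... | inj₁ _   = ≤-refl
  ... | inj₂ y≤x = y≤x

  max-lub : ∀ {x y b} → x ≤ b → y ≤ b → max x y ≤ b
  max-lub {x} {y} x≤b y≤b with total x y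
  ... | inj₁ _ = y≤b
  ... | inj₂ _ = x≤b

  maxF-ub : ∀ m (f : Fin (suc m) → Carrier) j → f j ≤ maxF m f
  maxF-ub zero    f zero    = ≤-refl
  maxF-ub (suc m) f zero    = max-ubˡ _ _
  maxF-ub (suc m) f (suc j) = ≤-trans (maxF-ub m (f ∘ suc) j) (max-ubʳ _ _)

  maxF-lub : ∀ m (f : Fin (suc m) → Carrier) {b} → (∀ j → f j ≤ b) → maxF m f ≤ b
  maxF-lub zero    f f≤b = f≤b zero
  maxF-lub (suc m) f f≤b = max-lub (f≤b zero) (maxF-lub m (f ∘ suc) (f≤b ∘ suc))

module Summation (F : OrderedField) where
  open OrderedField F
  open OrderedFieldProperties F
  open import Algebra.Properties.AbelianGroup +-abelianGroup using (⁻¹-∙-comm)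
  open import Algebra.Properties.Group +-group using (ε⁻¹≈ε)
  open import Algebra.Properties.CommutativeSemigroup +-commutativeSemigroup
    using () renaming (interchange to +-interchange)
  open IntegerCoefficientSolver commRing using (solve; _:+_; _:-_; con; _:=_)
  open ≈-Reasoning

  iverson : ∀ {A : Set} → Dec A → Carrier → Carrier
  iverson A? x = if does A? then x else 0#

  iverson-yes : ∀ {A : Set} (A? : Dec A) {x} → A → iverson A? x ≡ x
  iverson-yes A? a rewrite dec-true A? a = ≡.refl

  iverson-no : ∀ {A : Set} (A? : Dec A) {x} → ¬ A → iverson A? x ≡ 0#
  iverson-no A? ¬a rewrite dec-false A? ¬a = ≡.refl

  iverson-cong : ∀ {A : Set} (A? : Dec A) {x y} → (A → x ≈ y) → iverson A? x ≈ iverson A? y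
  iverson-cong (yes a) x≈y = x≈y a
  iverson-cong (no _)  x≈y = refl

  iverson-distrib-+ : ∀ {A : Set} (A? : Dec A) x y → iverson A? (x + y) ≈ iverson A? x + iverson A? y
  iverson-distrib-+ (yes _) x y = refl
  iverson-distrib-+ (no _)  x y = sym (+-identityʳ 0#)

  iverson-distrib-− : ∀ {A : Set} (A? : Dec A) x y → iverson A? x - iverson A? y ≈ iverson A? (x - y)
  iverson-distrib-− (yes _) x y = refl
  iverson-distrib-− (no _)  x y = -‿inverseʳ 0#

  iverson-comm : ∀ {A B : Set} (A? : Dec A) (B? : Dec B) x → iverson A? (iverson B? x) ≡ iverson B? (iverson A? x)
  iverson-comm (yes _) B?      x = ≡.refl
  iverson-comm (no _)  (yes _) x = ≡.refl
  iverson-comm (no _)  (no _)  x = ≡.refl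

  sumF-cong : ∀ m {f g : Fin m → Carrier} → (∀ j → f j ≈ g j) → sumF m f ≈ sumF m g
  sumF-cong zero    f≈g = refl
  sumF-cong (suc m) f≈g = +-cong (f≈g zero) (sumF-cong m (f≈g ∘ suc))

  sumF-distrib-+ : ∀ m (f g : Fin m → Carrier) → sumF m (λ j → f j + g j) ≈ sumF m f + sumF m g
  sumF-distrib-+ zero    f g = sym (+-identityʳ 0#)
  sumF-distrib-+ (suc m) f g = trans (+-congˡ (sumF-distrib-+ m (f ∘ suc) (g ∘ suc))) (+-interchange _ _ _ _)

  sumF-neg : ∀ m (f : Fin m → Carrier) → sumF m (λ j → - f j) ≈ - sumF m f
  sumF-neg zero    f = sym ε⁻¹≈ε
  sumF-neg (suc m) f = trans (+-congˡ (sumF-neg m (f ∘ suc))) (⁻¹-∙-comm _ _)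

  sumF-distrib-− : ∀ m (f g : Fin m → Carrier) → sumF m (λ j → f j - g j) ≈ sumF m f - sumF m g
  sumF-distrib-− m f g = trans (sumF-distrib-+ m f (λ j → - g j)) (+-congˡ (sumF-neg m g))

  *-distribˡ-sumF : ∀ m x (f : Fin m → Carrier) → x * sumF m f ≈ sumF m (λ j → x * f j)
  *-distribˡ-sumF zero    x f = zeroʳ x
  *-distribˡ-sumF (suc m) x f = trans (distribˡ x _ _) (+-congˡ (*-distribˡ-sumF m x (f ∘ suc)))

  sumF-const : ∀ m x → sumF m (λ _ → x) ≈ nat m * x
  sumF-const zero    x = sym (zeroˡ x)
  sumF-const (suc m) x = trans (+-cong (sym (*-identityˡ x)) (sumF-const m x)) (sym (distribʳ x 1# (nat m)))

  sumF-zero : ∀ m {f : Fin m → Carrier} → (∀ j → f j ≈ 0#) → sumF m f ≈ 0#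
  sumF-zero m f≈0 = trans (sumF-cong m f≈0) (trans (sumF-const m 0#) (zeroʳ (nat m)))

  sumF≈head : ∀ m (f : Fin (suc m) → Carrier) → (∀ j → f (suc j) ≈ 0#) → sumF (suc m) f ≈ f zero
  sumF≈head m f f≈0 = trans (+-congˡ (sumF-zero m f≈0)) (+-identityʳ (f zero))

  sumF-mono-≤ : ∀ m {f g : Fin m → Carrier} → (∀ j → f j ≤ g j) → sumF m f ≤ sumF m g
  sumF-mono-≤ zero    f≤g = ≤-refl
  sumF-mono-≤ (suc m) f≤g = +-mono₂-≤ (f≤g zero) (sumF-mono-≤ m (f≤g ∘ suc))

  sumF-iverson : ∀ m {A : Set} (A? : Dec A) (f : Fin m → Carrier) →
                 sumF m (λ j → iverson A? (f j)) ≈ iverson A? (sumF m f)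
  sumF-iverson m (yes _) f = refl
  sumF-iverson m (no _)  f = sumF-zero m (λ _ → refl)

  sumF-δ : ∀ m (i : Fin m) (f : Fin m → Carrier) → sumF m (λ j → iverson (j ≟ i) (f j)) ≈ f i
  sumF-δ (suc m) zero    f = sumF≈head m (λ j → iverson (j ≟ zero) (f j)) (λ _ → refl)
  sumF-δ (suc m) (suc i) f = trans (+-identityˡ _) (sumF-δ m i (f ∘ suc))

  iverson-trichotomy : ∀ {m} (i q : Fin m) x → iverson (i <? q) x + iverson (q <? i) x ≈ x - iverson (q ≟ i) x
  iverson-trichotomy i q x with <-cmp i q
  ... | tri< i<q i≢q q≮i
    rewrite iverson-yes (i <? q) {x} i<q | iverson-no (q <? i) {x} q≮i | iverson-no (q ≟ i) {x} (i≢q ∘ ≡.sym)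
    = solve 1 (λ x → x :+ con (+ 0) := x :- con (+ 0)) refl x
  ... | tri≈ i≮q i≡q q≮i
    rewrite iverson-no (i <? q) {x} i≮q | iverson-no (q <? i) {x} q≮i | iverson-yes (q ≟ i) {x} (≡.sym i≡q)
    = solve 1 (λ x → con (+ 0) :+ con (+ 0) := x :- x) refl x
  ... | tri> i≮q i≢q q<i
    rewrite iverson-no (i <? q) {x} i≮q | iverson-yes (q <? i) {x} q<i | iverson-no (q ≟ i) {x} (i≢q ∘ ≡.sym)
    = solve 1 (λ x → con (+ 0) :+ x := x :- con (+ 0)) refl x

  sumF-pairs-through : ∀ m (i : Fin m) (g : Fin m → Carrier) →
    sumF m (λ p → sumF m (λ q → iverson (p <? q) (iverson (p ≟ i) (g q) + iverson (q ≟ i) (g p))))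
    ≈ sumF m g - g i
  sumF-pairs-through m i g = begin
    sumF m (λ p → sumF m (λ q → iverson (p <? q) (iverson (p ≟ i) (g q) + iverson (q ≟ i) (g p))))
      ≈⟨ sumF-cong m (λ p → sumF-cong m (λ q → trans (iverson-distrib-+ (p <? q) _ _)
           (reflexive (≡.cong₂ _+_ (iverson-comm (p <? q) (p ≟ i) _) (iverson-comm (p <? q) (q ≟ i) _))))) ⟩
    sumF m (λ p → sumF m (λ q → iverson (p ≟ i) (iverson (p <? q) (g q)) + iverson (q ≟ i) (iverson (p <? q) (g p))))
      ≈⟨ sumF-cong m (λ p → sumF-distrib-+ m _ _) ⟩
    sumF m (λ p → sumF m (λ q → iverson (p ≟ i) (iverson (p <? q) (g q))) + sumF m (λ q → iverson (q ≟ i) (iverson (p <? q) (g p))))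
      ≈⟨ sumF-cong m (λ p → +-cong (sumF-iverson m (p ≟ i) _) (sumF-δ m i _)) ⟩
    sumF m (λ p → iverson (p ≟ i) (sumF m (λ q → iverson (p <? q) (g q))) + iverson (p <? i) (g p))
      ≈⟨ sumF-distrib-+ m _ _ ⟩
    sumF m (λ p → iverson (p ≟ i) (sumF m (λ q → iverson (p <? q) (g q)))) + sumF m (λ p → iverson (p <? i) (g p))
      ≈⟨ +-congʳ (sumF-δ m i _) ⟩
    sumF m (λ q → iverson (i <? q) (g q)) + sumF m (λ q → iverson (q <? i) (g q))
      ≈⟨ sumF-distrib-+ m _ _ ⟨
    sumF m (λ q → iverson (i <? q) (g q) + iverson (q <? i) (g q))
      ≈⟨ sumF-cong m (λ q → iverson-trichotomy i q (g q)) ⟩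
    sumF m (λ q → g q - iverson (q ≟ i) (g q))
      ≈⟨ sumF-distrib-− m _ _ ⟩
    sumF m g - sumF m (λ q → iverson (q ≟ i) (g q))
      ≈⟨ +-congˡ (-‿cong (sumF-δ m i g)) ⟩
    sumF m g - g i
      ∎

module IsolationIndex (F : OrderedField) {M : Set} (Met : PseudoMetric F M) where
  open OrderedField F
  open OrderedFieldProperties F using (two; two*half≈1; module ≈-Reasoning)
  open PseudoMetric Met
  open Teia F Met using (α)
  open IntegerCoefficientSolver commRing using (solve; _:+_; _:*_; _:-_; _:=_)
  open ≈-Reasoning

  α-self : ∀ y z → α y y z ≈ 0#
  α-self y z = begin
    half * (d y y + d y z - d y z)  ≈⟨ solve 3 (λ h a b → h :* (a :+ b :- b) := h :* a) refl half (d y y) (d y z) ⟩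
    half * d y y                    ≈⟨ *-congˡ (d-refl y) ⟩
    half * 0#                       ≈⟨ zeroʳ half ⟩
    0#                              ∎

  α-comm : ∀ x y z → α x y z ≈ α x z y
  α-comm x y z = *-congˡ (+-cong (+-comm _ _) (-‿cong (d-sym y z)))

  α-swap : ∀ x y z → α x y z + α y x z ≈ d x y
  α-swap x y z = begin
    half * (d x y + d x z - d y z) + half * (d y x + d y z - d x z)
      ≈⟨ +-congˡ (*-congˡ (+-congʳ (+-congʳ (d-sym y x)))) ⟩
    half * (d x y + d x z - d y z) + half * (d x y + d y z - d x z)
      ≈⟨ solve 4 (λ h a b c → h :* (a :+ b :- c) :+ h :* (a :+ c :- b) := (h :+ h) :* a) refl half (d x y) (d x z) (d y z) ⟩
    (half + half) * d x y
      ≈⟨ *-congʳ half-spec ⟩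
    1# * d x y
      ≈⟨ *-identityˡ _ ⟩
    d x y
      ∎

  α-diag : ∀ x y → α x y y ≈ d x y
  α-diag x y = begin
    α x y y            ≈⟨ +-identityʳ _ ⟨
    α x y y + 0#       ≈⟨ +-congˡ (trans (α-comm y x y) (α-self y x)) ⟨
    α x y y + α y x y  ≈⟨ α-swap x y y ⟩
    d x y              ∎

  α-exchange : ∀ x y z w → α x y w + α z x w ≈ α z y w + α x y z
  α-exchange x y z w = begin
    half * (d x y + d x w - d y w) + half * (d z x + d z w - d x w)
      ≈⟨ +-congˡ (*-congˡ (+-congʳ (+-congʳ (d-sym z x)))) ⟩
    half * (d x y + d x w - d y w) + half * (d x z + d z w - d x w)
      ≈⟨ solve 7 (λ h xy xw yw xz zw yz →
                    h :* (xy :+ xw :- yw) :+ h :* (xz :+ zw :- xw) := h :* (yz :+ zw :- yw) :+ h :* (xy :+ xz :- yz))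
                 refl half (d x y) (d x w) (d y w) (d x z) (d z w) (d y z) ⟩
    half * (d y z + d z w - d y w) + half * (d x y + d x z - d y z)
      ≈⟨ +-congʳ (*-congˡ (+-congʳ (+-congʳ (d-sym y z)))) ⟩
    half * (d z y + d z w - d y w) + half * (d x y + d x z - d y z)
      ∎

  α-swap-ends : ∀ x y z → α x y z + α z y x ≈ d x z
  α-swap-ends x y z = trans (+-cong (α-comm x y z) (α-comm z y x)) (α-swap x z y)

  two*α-difference : ∀ x y z w → two * (α x y z - α x y w) ≈ (d x z - d y z) - (d x w - d y w)
  two*α-difference x y z w = begin
    two * (half * (d x y + d x z - d y z) - half * (d x y + d x w - d y w))
      ≈⟨ solve 7 (λ t h xy xz yz xw yw →
                    t :* (h :* (xy :+ xz :- yz) :- h :* (xy :+ xw :- yw)) := (t :* h) :* ((xz :- yz) :- (xw :- yw)))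
                 refl two half (d x y) (d x z) (d y z) (d x w) (d y w) ⟩
    (two * half) * ((d x z - d y z) - (d x w - d y w))
      ≈⟨ trans (*-congʳ two*half≈1) (*-identityˡ _) ⟩
    (d x z - d y z) - (d x w - d y w)
      ∎

module TeiaProperties (F : OrderedField) {M : Set} (Met : PseudoMetric F M) (n : ℕ) where
  open OrderedField F
  open OrderedFieldProperties F
  open Summation F
  open PseudoMetric Met
  open Teia F Met using (α; 𝒟; ℳ; e; emax; ℋ; Φ; newE; newS; newA)
  open IsolationIndex F Met
  open IntegerCoefficientSolver commRing using (solve; _:+_; _:*_; _:-_; _:=_)

  k : ℕ
  k = suc n

  pairs : (Fin k → M) → Fin k → Fin k → Carrier
  pairs s p q = iverson (p <? q) (d (s p) (s q))

  -- 𝒟 sums a where-bound function, which cannot be named.  Unifying with the unfolded sum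
  -- exposes its entries outside row and column zero, stuck on the comparison suc p <? suc q.
  private
    summand-of-𝒟 : ∀ s → Σ (Fin n → Fin n → Carrier) (λ R →
      𝒟 n s ≡ (0# + sumF n (λ q → d (s zero) (s (suc q)))) + sumF n (λ p → 0# + sumF n (R p)))
    summand-of-𝒟 s = _ , ≡.refl

    summand-of-𝒟≡pairs : ∀ s p q → proj₁ (summand-of-𝒟 s) p q ≡ pairs s (suc p) (suc q)
    summand-of-𝒟≡pairs s p q with suc p <? suc q
    ... | yes p<q = ≡.sym (iverson-yes (suc p <? suc q) p<q)
    ... | no  p≮q = ≡.sym (iverson-no (suc p <? suc q) p≮q)

  𝒟≈sum-pairs : ∀ s → 𝒟 n s ≈ sumF k (λ p → sumF k (pairs s p))
  𝒟≈sum-pairs s = trans (reflexive (proj₂ (summand-of-𝒟 s)))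
    (+-congˡ (sumF-cong n (λ p → +-congˡ (sumF-cong n (λ q → reflexive (summand-of-𝒟≡pairs s p q))))))

  AgreeOnSuc : (Fin k → M) → (Fin k → M) → Set
  AgreeOnSuc s a = ∀ (j : Fin n) → s (suc j) ≡ a (suc j)

  ℳ-agree : ∀ s a → AgreeOnSuc s a → ℳ n s a ≈ nat k * d (a zero) (s zero)
  ℳ-agree s a hs = *-congˡ (sumF≈head n (λ j → d (a j) (s j)) (λ j →
    trans (reflexive (≡.cong (λ x → d x (s (suc j))) (≡.sym (hs j)))) (d-refl _)))

  e-agree : ∀ s a → AgreeOnSuc s a → ∀ E l → e n s a E l ≈ E l - α (s zero) (a zero) (s l)
  e-agree s a hs E l = +-congˡ (-‿cong (sumF≈head n (λ j → α (s j) (a j) (s l)) (λ j →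
    trans (reflexive (≡.cong (λ x → α (s (suc j)) x (s l)) (≡.sym (hs j)))) (α-self _ _))))

  newS-newA-agreeOnSuc : ∀ s a → AgreeOnSuc s a → ∀ i r → AgreeOnSuc (newS n s i r) (newA n a i r)
  newS-newA-agreeOnSuc s a hs zero    r j = hs j
  newS-newA-agreeOnSuc s a hs (suc m) r j with suc j ≟ suc m
  ... | yes _ = ≡.refl
  ... | no _  = hs j

  newS-≡ : ∀ s i r → newS n s i r i ≡ r
  newS-≡ s i r with i ≟ i
  ... | yes _   = ≡.refl
  ... | no i≢i = contradiction ≡.refl i≢i

  newS-≢ : ∀ s i r {j} → j ≢ i → newS n s i r j ≡ s j
  newS-≢ s i r {j} j≢i with j ≟ i
  ... | yes j≡i = contradiction j≡i j≢i
  ... | no _    = ≡.refl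

  distChange : (Fin k → M) → Fin k → M → Fin k → Carrier
  distChange s i r q = d r (s q) - d (s i) (s q)

  d-newS : ∀ s i r {p q} → p ≢ q →
           d (newS n s i r p) (newS n s i r q) - d (s p) (s q)
           ≈ iverson (p ≟ i) (distChange s i r q) + iverson (q ≟ i) (distChange s i r p)
  d-newS s i r {p} {q} p≢q with p ≟ i | q ≟ i
  ... | yes ≡.refl | yes ≡.refl = contradiction ≡.refl p≢q
  ... | yes ≡.refl | no _       = sym (+-identityʳ _)
  ... | no _       | yes ≡.refl = trans (+-cong (d-sym _ _) (-‿cong (d-sym _ _))) (sym (+-identityˡ _))
  ... | no _       | no _       = trans (-‿inverseʳ _) (sym (+-identityʳ 0#))

  𝒟-newS : ∀ s i r → 𝒟 n (newS n s i r) - 𝒟 n s ≈ sumF k (distChange s i r) - distChange s i r i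
  𝒟-newS s i r = begin
    𝒟 n s′ - 𝒟 n s
      ≈⟨ +-cong (𝒟≈sum-pairs s′) (-‿cong (𝒟≈sum-pairs s)) ⟩
    sumF k (λ p → sumF k (pairs s′ p)) - sumF k (λ p → sumF k (pairs s p))
      ≈⟨ sumF-distrib-− k (λ p → sumF k (pairs s′ p)) (λ p → sumF k (pairs s p)) ⟨
    sumF k (λ p → sumF k (pairs s′ p) - sumF k (pairs s p))
      ≈⟨ sumF-cong k (λ p → sumF-distrib-− k (pairs s′ p) (pairs s p)) ⟨
    sumF k (λ p → sumF k (λ q → pairs s′ p q - pairs s p q))
      ≈⟨ sumF-cong k (λ p → sumF-cong k (λ q →
           trans (iverson-distrib-− (p <? q) _ _) (iverson-cong (p <? q) (d-newS s i r ∘ <⇒≢)))) ⟩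
    sumF k (λ p → sumF k (λ q → iverson (p <? q) (iverson (p ≟ i) (g q) + iverson (q ≟ i) (g p))))
      ≈⟨ sumF-pairs-through k i g ⟩
    sumF k g - g i
      ∎
    where
    open ≈-Reasoning
    s′ : Fin k → M
    s′ = newS n s i r
    g : Fin k → Carrier
    g = distChange s i r

  ℋ-bound : ∀ s a E s′ a′ (b : Fin k → Carrier) t →
            (∀ l → e n s′ a′ (λ j → E j + b j) l ≤ emax n s a E + t) →
            ℋ n s′ a′ (λ j → E j + b j) ≤ ℋ n s a E + two * sumF k (λ l → t - b l)
  ℋ-bound s a E s′ a′ b t e′≤ = begin
    two * sumF k (λ l → emax′ - (E l + b l))
      ≤⟨ two*-mono-≤ (sumF-mono-≤ k (λ l → +-mono-≤ (- (E l + b l)) emax′≤)) ⟩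
    two * sumF k (λ l → (emax n s a E + t) - (E l + b l))
      ≈⟨ *-congˡ (sumF-cong k (λ l → solve 4 (λ m t El bl → (m :+ t) :- (El :+ bl) := (m :- El) :+ (t :- bl))
                                              refl (emax n s a E) t (E l) (b l))) ⟩
    two * sumF k (λ l → (emax n s a E - E l) + (t - b l))
      ≈⟨ *-congˡ (sumF-distrib-+ k (λ l → emax n s a E - E l) (λ l → t - b l)) ⟩
    two * (sumF k (λ l → emax n s a E - E l) + sumF k (λ l → t - b l))
      ≈⟨ distribˡ two _ _ ⟩
    ℋ n s a E + two * sumF k (λ l → t - b l)
      ∎
    where
    open ≤-Reasoning
    emax′ : Carrier
    emax′ = emax n s′ a′ (λ j → E j + b j)
    emax′≤ : emax′ ≤ emax n s a E + t
    emax′≤ = maxF-lub n (e n s′ a′ (λ j → E j + b j)) e′≤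

  module LazyRequest (s a : Fin k → M) (E : Fin k → Carrier) (hs : AgreeOnSuc s a) where
    r : M
    r = a zero

    s′ a′ : Fin k → Fin k → M
    s′ i = newS n s i r
    a′ i = newA n a i r

    β : Fin k → Fin k → Carrier
    β i l = α r (s i) (s l)

    e′ : Fin k → Fin k → Carrier
    e′ i = e n (s′ i) (a′ i) (newE n s E i r)

    e′-agree : ∀ i l → e′ i l ≈ (E l + β i l) - α (s′ i zero) (a′ i zero) (s′ i l)
    e′-agree i = e-agree (s′ i) (a′ i) (newS-newA-agreeOnSuc s a hs i r) (newE n s E i r)

    open-distance : ∀ i → d (a′ i zero) (s′ i zero) ≈ d (s i) (s zero)
    open-distance zero    = trans (d-refl r) (sym (d-refl (s zero)))
    open-distance (suc m) = reflexive (≡.cong (λ x → d x (s zero)) (≡.sym (hs m)))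

    e′-zero : ∀ l → e′ zero l ≈ e n s a E l + β zero zero
    e′-zero l = begin
      e′ zero l                                      ≈⟨ e′-agree zero l ⟩
      (E l + β zero l) - α r r (s′ zero l)           ≈⟨ a+c≈b+d⇒x+a-b≈x-c+d (E l) swap ⟩
      (E l - α (s zero) r (s l)) + β zero zero       ≈⟨ +-congʳ (e-agree s a hs E l) ⟨
      e n s a E l + β zero zero                      ∎
      where
      open ≈-Reasoning
      swap : β zero l + α (s zero) r (s l) ≈ α r r (s′ zero l) + β zero zero
      swap = trans (α-swap r (s zero) (s l))
                   (sym (trans (+-cong (α-self r _) (α-diag r (s zero))) (+-identityˡ _)))

    e′-unmoved : ∀ m l → l ≢ suc m → e′ (suc m) l ≈ e n s a E l + β (suc m) zero
    e′-unmoved m l l≢i = begin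
      e′ i l                                                ≈⟨ e′-agree i l ⟩
      (E l + β i l) - α (s zero) (a i) (s′ i l)            ≈⟨ +-congˡ (-‿cong (reflexive
                                                                 (≡.cong₂ (α (s zero)) (≡.sym (hs m)) (newS-≢ s i r l≢i)))) ⟩
      (E l + β i l) - α (s zero) (s i) (s l)               ≈⟨ a+c≈b+d⇒x+a-b≈x-c+d (E l) (α-exchange r (s i) (s zero) (s l)) ⟩
      (E l - α (s zero) r (s l)) + β i zero                 ≈⟨ +-congʳ (e-agree s a hs E l) ⟨
      e n s a E l + β i zero                                ∎
      where
      open ≈-Reasoning
      i : Fin k
      i = suc m

    e′-moved : ∀ m → E (suc m) + d (s (suc m)) r ≤ E zero + d (s zero) r →
               e′ (suc m) (suc m) ≤ e n s a E zero + β (suc m) zero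
    e′-moved m greedy = begin
      e′ i i                                                ≈⟨ e′-agree i i ⟩
      (E i + β i i) - α (s zero) (a i) (s′ i i)            ≈⟨ +-cong (+-congˡ (trans (α-diag r (s i)) (d-sym r (s i))))
                                                                 (-‿cong (reflexive (≡.cong₂ (α (s zero)) (≡.sym (hs m)) (newS-≡ s i r)))) ⟩
      (E i + d (s i) r) - α (s zero) (s i) r               ≤⟨ +-mono-≤ _ greedy ⟩
      (E zero + d (s zero) r) - α (s zero) (s i) r         ≈⟨ a+c≈b+d⇒x+a-b≈x-c+d (E zero) swap ⟩
      (E zero - α (s zero) r (s zero)) + β i zero           ≈⟨ +-congʳ (e-agree s a hs E zero) ⟨
      e n s a E zero + β i zero                             ∎
      where
      open ≤-Reasoning
      i : Fin k
      i = suc m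
      swap : d (s zero) r + α (s zero) r (s zero) ≈ α (s zero) (s i) r + β i zero
      swap = trans (trans (+-congˡ (trans (α-comm (s zero) r (s zero)) (α-self (s zero) r))) (+-identityʳ _))
                   (sym (α-swap-ends (s zero) (s i) r))

    e′-bound-suc : ∀ m → E (suc m) + d (s (suc m)) r ≤ E zero + d (s zero) r →
                   ∀ l → Dec (l ≡ suc m) → e′ (suc m) l ≤ emax n s a E + β (suc m) zero
    e′-bound-suc m greedy .(suc m) (yes ≡.refl) =
      ≤-trans (e′-moved m greedy) (+-mono-≤ _ (maxF-ub n (e n s a E) zero))
    e′-bound-suc m greedy l        (no l≢i)    =
      ≤-trans (≤-reflexive (e′-unmoved m l l≢i)) (+-mono-≤ _ (maxF-ub n (e n s a E) l))

    e′-bound : ∀ i → (∀ j → E i + d (s i) r ≤ E j + d (s j) r) → ∀ l → e′ i l ≤ emax n s a E + β i zero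
    e′-bound zero    _      l = ≤-trans (≤-reflexive (e′-zero l)) (+-mono-≤ _ (maxF-ub n (e n s a E) l))
    e′-bound (suc m) greedy l = e′-bound-suc m (greedy zero) l (l ≟ suc m)

    two*β-gap : ∀ i → two * sumF k (λ l → β i zero - β i l)
                      ≈ nat k * (d r (s zero) - d (s i) (s zero)) - sumF k (distChange s i r)
    two*β-gap i = begin
      two * sumF k (λ l → β i zero - β i l)           ≈⟨ *-distribˡ-sumF k two (λ l → β i zero - β i l) ⟩
      sumF k (λ l → two * (β i zero - β i l))         ≈⟨ sumF-cong k (λ l → two*α-difference r (s i) (s zero) (s l)) ⟩
      sumF k (λ l → (A - C) - distChange s i r l)     ≈⟨ sumF-distrib-− k (λ _ → A - C) (distChange s i r) ⟩
      sumF k (λ _ → A - C) - sumF k (distChange s i r) ≈⟨ +-congʳ (sumF-const k (A - C)) ⟩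
      nat k * (A - C) - sumF k (distChange s i r)      ∎
      where
      open ≈-Reasoning
      A C : Carrier
      A = d r (s zero)
      C = d (s i) (s zero)

    ℳ-change : ∀ i → ℳ n (s′ i) (a′ i) - ℳ n s a ≈ nat k * d (s i) (s zero) - nat k * d r (s zero)
    ℳ-change i = +-cong (trans (ℳ-agree (s′ i) (a′ i) (newS-newA-agreeOnSuc s a hs i r)) (*-congˡ (open-distance i)))
                        (-‿cong (ℳ-agree s a hs))

    distChange-moved : ∀ i → d (s i) r - distChange s i r i ≈ 0#
    distChange-moved i = begin
      d (s i) r - (d r (s i) - d (s i) (s i))    ≈⟨ +-congˡ (-‿cong (+-congʳ (d-sym r (s i)))) ⟩
      d (s i) r - (d (s i) r - d (s i) (s i))    ≈⟨ solve 2 (λ c z → c :- (c :- z) := z) refl (d (s i) r) (d (s i) (s i)) ⟩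
      d (s i) (s i)                              ≈⟨ d-refl (s i) ⟩
      0#                                         ∎
      where
      open ≈-Reasoning

    Φ-decrease : ∀ i → (∀ l → e′ i l ≤ emax n s a E + β i zero) →
                 (Φ n (s′ i) (a′ i) (newE n s E i r) - Φ n s a E) + d (s i) r ≤ 0#
    Φ-decrease i e′≤ = begin
      ((D′ + M′ + H′) - (D + M₀ + H)) + c
        ≤⟨ +-mono-≤ c (+-mono-≤ (- (D + M₀ + H)) (+-monoʳ-≤ (D′ + M′) (ℋ-bound s a E (s′ i) (a′ i) (β i) (β i zero) e′≤))) ⟩
      ((D′ + M′ + (H + T)) - (D + M₀ + H)) + c
        ≈⟨ solve 7 (λ D′ M′ H T D M₀ c → ((D′ :+ M′ :+ (H :+ T)) :- (D :+ M₀ :+ H)) :+ c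
                                          := (D′ :- D) :+ ((M′ :- M₀) :+ (T :+ c))) refl D′ M′ H T D M₀ c ⟩
      (D′ - D) + ((M′ - M₀) + (T + c))
        ≈⟨ +-cong (𝒟-newS s i r) (+-cong (ℳ-change i) (+-congʳ (two*β-gap i))) ⟩
      (G - g) + ((K * C - K * A) + ((K * (A - C) - G) + c))
        ≈⟨ solve 6 (λ G g K C A c → (G :- g) :+ ((K :* C :- K :* A) :+ ((K :* (A :- C) :- G) :+ c)) := c :- g)
                   refl G g K C A c ⟩
      c - g
        ≈⟨ distChange-moved i ⟩
      0#
        ∎
      where
      open ≤-Reasoning
      D′ M′ H′ D M₀ H T c K A C G g : Carrier
      D′ = 𝒟 n (s′ i); M′ = ℳ n (s′ i) (a′ i); H′ = ℋ n (s′ i) (a′ i) (newE n s E i r)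
      D = 𝒟 n s; M₀ = ℳ n s a; H = ℋ n s a E
      T = two * sumF k (λ l → β i zero - β i l)
      c = d (s i) r; K = nat k; A = d r (s zero); C = d (s i) (s zero)
      G = sumF k (distChange s i r); g = distChange s i r i

lemma4 : (F : OrderedField) {M : Set} (Met : PseudoMetric F M) (n : ℕ)
         (s a : Fin (suc n) → M) (E : Fin (suc n) → OrderedField.Carrier F) →
         (∀ (j : Fin n) → s (suc j) ≡ a (suc j)) →
         (i : Fin (suc n)) →
         (∀ j → OrderedField._≤_ F
                  (OrderedField._+_ F (E i) (PseudoMetric.d Met (s i) (a zero)))
                  (OrderedField._+_ F (E j) (PseudoMetric.d Met (s j) (a zero)))) →
         (∀ (j : Fin n) → Teia.newS F Met n s i (a zero) (suc j)
                          ≡ Teia.newA F Met n a i (a zero) (suc j))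
         × OrderedField._≤_ F
             (OrderedField._+_ F
               (OrderedField._-_ F
                 (Teia.Φ F Met n (Teia.newS F Met n s i (a zero))
                                 (Teia.newA F Met n a i (a zero))
                                 (Teia.newE F Met n s E i (a zero)))
                 (Teia.Φ F Met n s a E))
               (PseudoMetric.d Met (s i) (a zero)))
             (OrderedField.0# F)
lemma4 F Met n s a E hs i greedy =
  newS-newA-agreeOnSuc s a hs i (a zero) , Φ-decrease i (e′-bound i greedy)
  where
  open TeiaProperties F Met n
  open LazyRequest s a E hs
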